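{- Let $(L,\vee,\wedge,0,1)$ be a complemented modular lattice and $a,b,c\in L$. Then: (i) if $a\le_1 b\to c$ then $a\wedge b\le c$; (ii) $a\wedge b\le c$ if and only if $a\wedge b\le_1 b\to c$.
   Context: A bounded lattice is complemented if every element $a$ has some $b$ with $a\vee b=1$, $a\wedge b=0$ (complements need not be unique); lattices are non-trivial. For $a\in L$, $a^+:=\{x\in L\mid a\vee x=1,\ a\wedge x=0\}$. For $A,B\subseteq L$, $A\vee B:=\{x\vee y\mid x\in A,y\in B\}$; singletons are identified with elements. Define $b\to c:=b^+\vee(b\wedge c)=\{x\vee(b\wedge c)\mid x\in b^+\}$. For $d\in L$ and $B\subseteq L$, $d\le_1 B$ means there exists $y\in B$ with $d\le y$. -}

module Defs where

open import Level using (Level; _⊔_) renaming (suc to lsuc)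
open import Data.Product using (Σ; ∃; _×_; _,_)
open import Relation.Nullary using (¬_)
open import Relation.Unary using (Pred; _∈_)
open import Relation.Binary.Lattice.Bundles using (BoundedLattice)

IsModular : ∀ {c ℓ₁ ℓ₂} → BoundedLattice c ℓ₁ ℓ₂ → Set (c ⊔ ℓ₁ ⊔ ℓ₂)
IsModular L = ∀ x y z → x ≤ z → (x ∨ (y ∧ z)) ≈ ((x ∨ y) ∧ z)
  where open BoundedLattice L

module LatticeSets {c ℓ₁ ℓ₂} (L : BoundedLattice c ℓ₁ ℓ₂) where
  open BoundedLattice L

  IsComplementOf : Carrier → Carrier → Set ℓ₁
  IsComplementOf a x = ((a ∨ x) ≈ ⊤) × ((a ∧ x) ≈ ⊥)

  IsComplemented : Set (c ⊔ ℓ₁)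
  IsComplemented = ∀ a → ∃ λ b → IsComplementOf a b

  IsNonTrivial : Set ℓ₁
  IsNonTrivial = ¬ (⊥ ≈ ⊤)

  _⁺ : Carrier → Pred Carrier ℓ₁
  (a ⁺) x = IsComplementOf a x

  -- b → c = b⁺ ∨ (b ∧ c) = { x ∨ (b ∧ c) | x ∈ b⁺ }  (membership up to ≈)
  _⟶_ : Carrier → Carrier → Pred Carrier (c ⊔ ℓ₁)
  (b ⟶ c') z = Σ Carrier λ x → (x ∈ (b ⁺)) × (z ≈ (x ∨ (b ∧ c')))

  _≤₁_ : ∀ {ℓ} → Carrier → Pred Carrier ℓ → Set (c ⊔ ℓ ⊔ ℓ₂)
  d ≤₁ B = Σ Carrier λ y → (y ∈ B) × (d ≤ y)

open LatticeSets using (IsComplemented; IsNonTrivial)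

record ComplementedModularLattice c ℓ₁ ℓ₂ : Set (lsuc (c ⊔ ℓ₁ ⊔ ℓ₂)) where
  field
    boundedLattice : BoundedLattice c ℓ₁ ℓ₂
    modular        : IsModular boundedLattice
    complemented   : IsComplemented boundedLattice
    nonTrivial     : IsNonTrivial boundedLattice
  open BoundedLattice boundedLattice public

module Submission where

open import Defs
open import Data.Product using (Σ; _×_; _,_)
open import Function.Bundles using (_⇔_; mk⇔)
open import Relation.Unary using (_∈_)
open import Relation.Binary.Lattice.Bundles using (BoundedLattice)
import Relation.Binary.Lattice.Properties.MeetSemilattice as MeetProperties
import Relation.Binary.Reasoning.PartialOrder as ≤-Reasoning

-- Every element of b ⟶ c has the form x ∨ (b ∧ c) with x a complement of b, and
-- modularity gives (x ∨ (b ∧ c)) ∧ b ≈ (b ∧ c) ∨ (x ∧ b) ≈ b ∧ c.  So meeting any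
-- element of b ⟶ c with b lands below c, which is (i).  Conversely b ∧ c lies below
-- every element of b ⟶ c, a set that complementedness makes non-empty, which gives (ii).

module _ {c ℓ₁ ℓ₂} (L : BoundedLattice c ℓ₁ ℓ₂) where
  open BoundedLattice L
  open LatticeSets L
  open MeetProperties meetSemilattice using (∧-monotonic; ∧-comm)
  open ≤-Reasoning poset

  x∧y≤[x∧y]∧y : ∀ x y → x ∧ y ≤ (x ∧ y) ∧ y
  x∧y≤[x∧y]∧y x y = ∧-greatest refl (x∧y≤y x y)

  x∧y≤z⇒x∧y≤y∧z : ∀ {x y z} → x ∧ y ≤ z → x ∧ y ≤ y ∧ z
  x∧y≤z⇒x∧y≤y∧z {x} {y} x∧y≤z = ∧-greatest (x∧y≤y x y) x∧y≤z

  b∧c≤⟶ : ∀ {b c' y} → y ∈ (b ⟶ c') → b ∧ c' ≤ y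
  b∧c≤⟶ {b} {c'} (x , _ , y≈) = trans (y≤x∨y x (b ∧ c')) (reflexive (Eq.sym y≈))

  ⟶-nonempty : IsComplemented → ∀ b c' → Σ Carrier (_∈ (b ⟶ c'))
  ⟶-nonempty complemented b c' =
    let x , x∈b⁺ = complemented b in x ∨ (b ∧ c') , x , x∈b⁺ , Eq.refl

  module _ (modular : IsModular L) where

    [x∨b∧c]∧b≤c : ∀ {x} b c' → x ∧ b ≈ ⊥ → (x ∨ (b ∧ c')) ∧ b ≤ c'
    [x∨b∧c]∧b≤c {x} b c' x∧b≈⊥ = begin
      (x ∨ (b ∧ c')) ∧ b  ≤⟨ ∧-monotonic (∨-least (y≤x∨y _ _) (x≤x∨y _ _)) refl ⟩
      ((b ∧ c') ∨ x) ∧ b  ≈⟨ Eq.sym (modular (b ∧ c') x b (x∧y≤x b c')) ⟩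
      (b ∧ c') ∨ (x ∧ b)  ≤⟨ ∨-least (x∧y≤y b c') (trans (reflexive x∧b≈⊥) (minimum c')) ⟩
      c'                  ∎

    ≤₁⟶⇒∧≤ : ∀ a b c' → a ≤₁ (b ⟶ c') → a ∧ b ≤ c'
    ≤₁⟶⇒∧≤ a b c' (y , (x , (_ , b∧x≈⊥) , y≈) , a≤y) = begin
      a ∧ b               ≤⟨ ∧-greatest (trans (x∧y≤x a b) (trans a≤y (reflexive y≈))) (x∧y≤y a b) ⟩
      (x ∨ (b ∧ c')) ∧ b  ≤⟨ [x∨b∧c]∧b≤c b c' (Eq.trans (∧-comm x b) b∧x≈⊥) ⟩
      c'                  ∎

theorem3p2 : ∀ {c ℓ₁ ℓ₂} (M : ComplementedModularLattice c ℓ₁ ℓ₂)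
    → let open ComplementedModularLattice M in
    let open LatticeSets boundedLattice in
    ∀ (a b c' : Carrier)
    → (a ≤₁ (b ⟶ c') → (a ∧ b) ≤ c')
    × (((a ∧ b) ≤ c') ⇔ ((a ∧ b) ≤₁ (b ⟶ c')))
theorem3p2 M a b c' = ≤₁⟶⇒∧≤ L modular a b c' , mk⇔ ∧≤⇒∧≤₁⟶ ∧≤₁⟶⇒∧≤
  where
  open ComplementedModularLattice M renaming (boundedLattice to L)
  open LatticeSets L

  ∧≤⇒∧≤₁⟶ : a ∧ b ≤ c' → (a ∧ b) ≤₁ (b ⟶ c')
  ∧≤⇒∧≤₁⟶ a∧b≤c' =
    let y , y∈b⟶c' = ⟶-nonempty L complemented b c'
    in y , y∈b⟶c' , trans (x∧y≤z⇒x∧y≤y∧z L a∧b≤c') (b∧c≤⟶ L y∈b⟶c')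

  ∧≤₁⟶⇒∧≤ : (a ∧ b) ≤₁ (b ⟶ c') → a ∧ b ≤ c'
  ∧≤₁⟶⇒∧≤ a∧b≤₁b⟶c' =
    trans (x∧y≤[x∧y]∧y L a b) (≤₁⟶⇒∧≤ L modular (a ∧ b) b c' a∧b≤₁b⟶c')
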